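{- Let $G$ be a connected graph of order $n\ge 2$ with vertices $u_1,\dots,u_n$, and let $H_1,\dots,H_n$ be graphs each having at least one edge. Then $$\dim_l(G\odot\mathcal{H})=\sum_{j=1}^n\bigl(\dim_l(K_1+H_j)-\alpha_j\bigr),$$ where $\alpha_j=1$ if the vertex of $K_1$ belongs to some local metric basis of $K_1+H_j$, and $\alpha_j=0$ otherwise.
   Context: The corona product $G\odot\mathcal{H}$, for $\mathcal{H}=(H_1,\dots,H_n)$, is obtained from $G$ and disjoint copies of $H_1,\dots,H_n$ by joining by an edge every vertex of $H_i$ to $u_i$, for each $i$. The join $K_1+H$ is obtained from $H$ by adding a new vertex adjacent to all vertices of $H$. For a connected graph $G$, a set $W\subseteq V(G)$ is a local metric generator if for every pair of adjacent vertices $x,y$ there is $w\in W$ with $d_G(x,w)\neq d_G(y,w)$ ($d_G$ the shortest-path distance); $\dim_l(G)$ is the minimum cardinality of a local metric generator, and a local metric generator of this cardinality is a local metric basis. -}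

module Defs where

open import Data.Nat using (ℕ; zero; suc; _≤_)
open import Data.Bool using (Bool; true; false)
open import Data.Fin using (Fin)
open import Data.Unit using (⊤; tt)
open import Data.Sum using (_⊎_; inj₁; inj₂)
open import Data.Product using (Σ; _×_; _,_; ∃; ∃-syntax)
open import Data.List using (List; length)
open import Data.List.Membership.Propositional using (_∈_)
open import Data.List.Relation.Unary.Unique.Propositional using (Unique)
open import Relation.Binary.PropositionalEquality using (_≡_; _≢_)
open import Relation.Nullary using (¬_)

record Graph (V : Set) : Set where
  field
    adj   : V → V → Bool
    sym   : ∀ x y → adj x y ≡ adj y x
    irrefl : ∀ x → adj x x ≡ false
open Graph public

module _ {V : Set} (G : Graph V) where

  data Walk : V → V → ℕ → Set where
    here : ∀ {x} → Walk x x 0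
    step : ∀ {x y z k} → adj G x y ≡ true → Walk y z k → Walk x z (suc k)

  Connected : Set
  Connected = ∀ x y → ∃[ k ] Walk x y k

  Dist : V → V → ℕ → Set
  Dist x y k = Walk x y k × (∀ k′ → Walk x y k′ → k ≤ k′)

  HasEdge : Set
  HasEdge = ∃[ x ] ∃[ y ] adj G x y ≡ true

  IsLocalMetricGenerator : List V → Set
  IsLocalMetricGenerator W =
    ∀ x y → adj G x y ≡ true →
      ∃[ w ] (w ∈ W × ∃[ a ] ∃[ b ] (Dist x w a × Dist y w b × a ≢ b))

  IsLocalMetricBasis : List V → Set
  IsLocalMetricBasis W =
    Unique W × IsLocalMetricGenerator W ×
    (∀ W′ → Unique W′ → IsLocalMetricGenerator W′ → length W ≤ length W′)

  IsLocalMetricDim : ℕ → Set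
  IsLocalMetricDim k = ∃[ W ] (IsLocalMetricBasis W × length W ≡ k)

-- Join K₁ + H : the new vertex is inj₁ tt, adjacent to every vertex of H.
join-K1 : ∀ {V} → Graph V → Graph (⊤ ⊎ V)
join-K1 H = record { adj = a ; sym = s ; irrefl = i }
  where
  a : _ → _ → Bool
  a (inj₁ _) (inj₁ _) = false
  a (inj₁ _) (inj₂ _) = true
  a (inj₂ _) (inj₁ _) = true
  a (inj₂ x) (inj₂ y) = adj H x y
  s : ∀ x y → a x y ≡ a y x
  s (inj₁ _) (inj₁ _) = _≡_.refl
  s (inj₁ _) (inj₂ _) = _≡_.refl
  s (inj₂ _) (inj₁ _) = _≡_.refl
  s (inj₂ x) (inj₂ y) = sym H x y
  i : ∀ x → a x x ≡ false
  i (inj₁ _) = _≡_.refl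
  i (inj₂ x) = irrefl H x

-- Corona product G ⊙ (H₁,…,Hₙ): vertices are inj₁ i (vertex u_i of G) and
-- inj₂ (i , v) (vertex v of the copy of H_i), which is joined to u_i.
CoronaV : (n : ℕ) → (m : Fin n → ℕ) → Set
CoronaV n m = Fin n ⊎ Σ (Fin n) (λ i → Fin (m i))

corona : ∀ {n} → Graph (Fin n) → {m : Fin n → ℕ} →
         ((i : Fin n) → Graph (Fin (m i))) → Graph (CoronaV n m)
corona {n} G {m} H = record { adj = a ; sym = s ; irrefl = i }
  where
  open import Data.Fin using (_≟_)
  open import Relation.Nullary using (yes; no)
  open import Relation.Binary.PropositionalEquality using (refl)
  a : CoronaV n m → CoronaV n m → Bool
  a (inj₁ x) (inj₁ y) = adj G x y
  a (inj₁ x) (inj₂ (j , _)) with x ≟ j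
  ... | yes _ = true
  ... | no _ = false
  a (inj₂ (j , _)) (inj₁ x) with x ≟ j
  ... | yes _ = true
  ... | no _ = false
  a (inj₂ (j , u)) (inj₂ (k , v)) with j ≟ k
  ... | yes refl = adj (H j) u v
  ... | no _ = false
  s : ∀ x y → a x y ≡ a y x
  s (inj₁ x) (inj₁ y) = sym G x y
  s (inj₁ x) (inj₂ (j , _)) with x ≟ j
  ... | yes _ = refl
  ... | no _ = refl
  s (inj₂ (j , _)) (inj₁ x) with x ≟ j
  ... | yes _ = refl
  ... | no _ = refl
  s (inj₂ (j , u)) (inj₂ (k , v)) with j ≟ k | k ≟ j
  ... | yes refl | yes refl = sym (H j) u v
  ... | yes refl | no ne = Data.Empty.⊥-elim (ne refl)
    where import Data.Empty
  ... | no ne | yes refl = Data.Empty.⊥-elim (ne refl)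
    where import Data.Empty
  ... | no _ | no _ = refl
  i : ∀ x → a x x ≡ false
  i (inj₁ x) = irrefl G x
  i (inj₂ (j , u)) with j ≟ j
  ... | yes refl = irrefl (H j) u
  ... | no ne = Data.Empty.⊥-elim (ne refl)
    where import Data.Empty

Alpha : ∀ {V} → Graph V → ℕ → Set
Alpha H α =
  (α ≡ 1 × ∃[ W ] (IsLocalMetricBasis (join-K1 H) W × inj₁ tt ∈ W)) ⊎
  (α ≡ 0 × ¬ (∃[ W ] (IsLocalMetricBasis (join-K1 H) W × inj₁ tt ∈ W)))

module Submission where

-- For a graph H let δ(x,w) be 0, 1 or 2 according as x = w, x ~ w or neither;
-- an adjacency generator of H is a set S such that every edge xy has some
-- w ∈ S with δ(x,w) ≠ δ(y,w).  A cone of H in a graph Γ is an induced copy of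
-- H with an apex adjacent to the whole copy, the apex being the only vertex
-- outside the copy adjacent to it; K₁ + H and each copy Hᵢ in G ⊙ ℋ (apex uᵢ)
-- are cones.  In a cone, distances inside the copy are given by δ and vertices
-- outside the copy are equidistant from the whole copy, so local metric
-- generators of Γ restrict to adjacency generators of H, and adjacency
-- generators of H resolve the edges of the copy.  For K₁ + H this shows that
-- the adjacency dimension of H is dim_l(K₁ + H) − α (join-reduction).  In the
-- corona, the union of minimum adjacency generators of the Hᵢ also resolves
-- the edges at the uᵢ (using n ≥ 2, connectivity and the edges of the Hᵢ) and
-- is minimum by a counting argument (corona-dimension).

open import Data.Nat using (ℕ; _≤_; _∸_)
open import Data.Fin using (Fin)
open import Data.List using (map; allFin)
open import Data.Nat.ListAction using (sum)
open import Defs renaming (sym to adj-sym)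

open import Data.Nat using (zero; suc; _<_; _+_; z≤n; s≤s; _≤?_)
open import Data.Nat.Properties
  using (≤-refl; ≤-trans; ≤-antisym; ≤-reflexive; m≤n⇒m≤1+n; ≰⇒>; ≤∧≢⇒<;
         +-mono-≤; +-suc; ∸-monoˡ-≤; 1+n≢n; module ≤-Reasoning)
  renaming (_≟_ to _≟ℕ_)
open import Data.Bool using (true; false; if_then_else_)
import Data.Bool.Properties as Bool
open import Data.Fin using (zero; suc) renaming (_≟_ to _≟ᶠ_)
import Data.Fin.Properties as Fin
open import Data.Maybe using (Maybe; just; nothing)
open import Data.Maybe.Properties using (just-injective)
open import Data.Unit using (⊤; tt)
open import Data.Sum using (_⊎_; inj₁; inj₂; [_,_])
import Data.Sum.Properties as Sum
open import Data.Product using (Σ; _×_; _,_; ∃; ∃-syntax)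
import Data.Product.Properties as Product
open import Data.Empty using (⊥-elim)
open import Function using (_∘_; const; id)
open import Relation.Binary.PropositionalEquality hiding ([_])
open import Relation.Binary using (DecidableEquality)
open import Relation.Nullary using (Dec; yes; no; ¬_)
open import Relation.Nullary.Decidable using (map′; _×-dec_; _⊎-dec_)
open import Data.List using (List; []; _∷_; length; tabulate; concat; mapMaybe)
open import Data.List.Properties using (length-++; length-map; map-tabulate; tabulate-cong)
open import Data.List.Membership.Propositional using (_∈_; _∉_)
open import Data.List.Membership.Propositional.Properties
  using (∈-map⁺; ∈-map⁻; ∈-concat⁺′; ∈-tabulate⁺)
open import Data.List.Relation.Unary.Any using (here; there)
open import Data.List.Relation.Unary.All using (All; []; _∷_; universal)
import Data.List.Relation.Unary.All.Properties as All
open import Data.List.Relation.Unary.All.Properties using (All¬⇒¬Any)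
import Data.List.Relation.Unary.AllPairs.Properties as AllPairs
open import Data.List.Relation.Unary.Unique.Propositional using (Unique; []; _∷_)
import Data.List.Relation.Unary.Unique.Propositional.Properties as Unique
open import Data.List.Relation.Binary.Disjoint.Propositional using (Disjoint)

∑ : ∀ {n} → (Fin n → ℕ) → ℕ
∑ f = sum (tabulate f)

∑-zero : ∀ n → ∑ {n} (const 0) ≡ 0
∑-zero zero = refl
∑-zero (suc n) = ∑-zero n

∑-mono : ∀ {n} {f g : Fin n → ℕ} → (∀ i → f i ≤ g i) → ∑ f ≤ ∑ g
∑-mono {zero} f≤g = z≤n
∑-mono {suc n} f≤g = +-mono-≤ (f≤g zero) (∑-mono (f≤g ∘ suc))

∑-bump : ∀ {n} {f g : Fin n → ℕ} (j : Fin n) →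
         (∀ i → i ≢ j → f i ≤ g i) → f j ≤ suc (g j) → ∑ f ≤ suc (∑ g)
∑-bump zero f≤g fj≤ = +-mono-≤ fj≤ (∑-mono (λ i → f≤g (suc i) (λ ())))
∑-bump {g = g} (suc j) f≤g fj≤ =
  ≤-trans (+-mono-≤ (f≤g zero (λ ()))
                    (∑-bump j (λ i i≢j → f≤g (suc i) (i≢j ∘ Fin.suc-injective)) fj≤))
          (≤-reflexive (+-suc (g zero) _))

module _ {A : Set} where

  length-concat : (xss : List (List A)) → length (concat xss) ≡ sum (map length xss)
  length-concat [] = refl
  length-concat (xs ∷ xss) = trans (length-++ xs) (cong (length xs +_) (length-concat xss))

module _ {A B : Set} (f : A → Maybe B) where

  ∈-mapMaybe⁺ : ∀ {x y xs} → x ∈ xs → f x ≡ just y → y ∈ mapMaybe f xs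
  ∈-mapMaybe⁺ {x} {xs = _ ∷ xs} (here refl) fx with f x
  ... | just _ = here (just-injective (sym fx))
  ∈-mapMaybe⁺ {xs = x′ ∷ xs} (there x∈) fx with f x′
  ... | nothing = ∈-mapMaybe⁺ x∈ fx
  ... | just _ = there (∈-mapMaybe⁺ x∈ fx)

  length-mapMaybe∷ : ∀ x xs → length (mapMaybe f (x ∷ xs)) ≤ suc (length (mapMaybe f xs))
  length-mapMaybe∷ x xs with f x
  ... | nothing = m≤n⇒m≤1+n ≤-refl
  ... | just _ = ≤-refl

  module _ (f-injective : ∀ {x y b} → f x ≡ just b → f y ≡ just b → x ≡ y) where

    all-distinct : ∀ {x b} xs → All (x ≢_) xs → f x ≡ just b → All (b ≢_) (mapMaybe f xs)
    all-distinct [] [] _ = []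
    all-distinct (y ∷ xs) (x≢y ∷ x∉) fx with f y in fy
    ... | nothing = all-distinct xs x∉ fx
    ... | just c = (λ { refl → x≢y (f-injective fx fy) }) ∷ all-distinct xs x∉ fx

    mapMaybe-unique : ∀ {xs} → Unique xs → Unique (mapMaybe f xs)
    mapMaybe-unique [] = []
    mapMaybe-unique {x ∷ xs} (x∉ ∷ u) with f x in fx
    ... | nothing = mapMaybe-unique u
    ... | just b = all-distinct xs x∉ fx ∷ mapMaybe-unique u

defined? : ∀ {B : Set} (m : Maybe B) → Dec (∃[ u ] m ≡ just u)
defined? (just u) = yes (u , refl)
defined? nothing = no λ ()

count-preimages : ∀ {n} {A : Set} {B : Fin n → Set} (f : ∀ i → A → Maybe (B i)) →
  (∀ {x i j u v} → f i x ≡ just u → f j x ≡ just v → i ≡ j) →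
  ∀ xs → ∑ (λ i → length (mapMaybe (f i) xs)) ≤ length xs
count-preimages {n} f exclusive [] = ≤-reflexive (∑-zero n)
count-preimages f exclusive (x ∷ xs) with Fin.any? (λ i → defined? (f i x))
... | yes (j , u , fj) =
      ≤-trans (∑-bump j unchanged (length-mapMaybe∷ (f j) x xs)) (s≤s (count-preimages f exclusive xs))
  where
  unchanged : ∀ i → i ≢ j → length (mapMaybe (f i) (x ∷ xs)) ≤ length (mapMaybe (f i) xs)
  unchanged i i≢j with f i x in fi
  ... | nothing = ≤-refl
  ... | just _ = ⊥-elim (i≢j (exclusive fi fj))
... | no none = m≤n⇒m≤1+n (≤-trans (∑-mono unchanged) (count-preimages f exclusive xs))
  where
  unchanged : ∀ i → length (mapMaybe (f i) (x ∷ xs)) ≤ length (mapMaybe (f i) xs)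
  unchanged i with f i x in fi
  ... | nothing = ≤-refl
  ... | just u = ⊥-elim (none (i , u , fi))

module _ {V : Set} (Γ : Graph V) where

  walk-zero : ∀ {x y} → Walk Γ x y 0 → x ≡ y
  walk-zero here = refl

  walk-one : ∀ {x y} → Walk Γ x y 1 → adj Γ x y ≡ true
  walk-one (step x~y here) = x~y

  walk-snoc : ∀ {x y z k} → Walk Γ x y k → adj Γ y z ≡ true → Walk Γ x z (suc k)
  walk-snoc here y~z = step y~z here
  walk-snoc (step x~x′ r) y~z = step x~x′ (walk-snoc r y~z)

  dist-unique : ∀ {x y a b} → Dist Γ x y a → Dist Γ x y b → a ≡ b
  dist-unique (wa , min-a) (wb , min-b) = ≤-antisym (min-a _ wb) (min-b _ wa)

  self-dist : ∀ x → Dist Γ x x 0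
  self-dist x = here , λ _ _ → z≤n

  edge-dist : ∀ {x y} → adj Γ x y ≡ true → Dist Γ x y 1
  edge-dist {x} x~y = step x~y here , bound
    where
    bound : ∀ k → Walk Γ x _ k → 1 ≤ k
    bound zero here with trans (sym x~y) (irrefl Γ x)
    ... | ()
    bound (suc k) _ = s≤s z≤n

  two-step-dist : ∀ {x y z} → x ≢ y → adj Γ x y ≡ false →
                  adj Γ x z ≡ true → adj Γ z y ≡ true → Dist Γ x y 2
  two-step-dist {x} {y} x≢y x≁y x~z z~y = step x~z (step z~y here) , bound
    where
    bound : ∀ k → Walk Γ x y k → 2 ≤ k
    bound zero w = ⊥-elim (x≢y (walk-zero w))
    bound (suc zero) w with trans (sym (walk-one w)) x≁y
    ... | ()
    bound (suc (suc k)) _ = s≤s (s≤s z≤n)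

  Resolves : List V → V → V → Set
  Resolves W x y = ∃[ w ] (w ∈ W × ∃[ a ] ∃[ b ] (Dist Γ x w a × Dist Γ y w b × a ≢ b))

  resolves-sym : ∀ {W x y} → Resolves W x y → Resolves W y x
  resolves-sym (w , w∈W , a , b , da , db , a≢b) = w , w∈W , b , a , db , da , a≢b ∘ sym

-- On a finite graph with decidable equality, any walk can be shortened to a
-- shortest one, so the distance exists.
module ShortestWalks {V : Set} (Γ : Graph V) (_≟_ : DecidableEquality V)
  (any? : ∀ {P : V → Set} → (∀ v → Dec (P v)) → Dec (∃ P)) where

  walk? : ∀ k x y → Dec (Walk Γ x y k)
  walk? zero x y = map′ (λ { refl → here }) (walk-zero Γ) (x ≟ y)
  walk? (suc k) x y =
    map′ (λ { (_ , x~z , r) → step x~z r }) (λ { (step x~z r) → _ , x~z , r })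
         (any? (λ z → (adj Γ x z Bool.≟ true) ×-dec walk? k z y))

  shortest-below : ∀ x y k → (∀ j → j < k → ¬ Walk Γ x y j) ⊎ ∃[ a ] Dist Γ x y a
  shortest-below x y zero = inj₁ (λ _ ())
  shortest-below x y (suc k) with shortest-below x y k
  ... | inj₂ dist = inj₂ dist
  ... | inj₁ none with walk? k x y
  ...   | yes w = inj₂ (k , w , bound)
    where
    bound : ∀ j → Walk Γ x y j → k ≤ j
    bound j wj with k ≤? j
    ... | yes k≤j = k≤j
    ... | no k≰j = ⊥-elim (none j (≰⇒> k≰j) wj)
  ...   | no ¬w = inj₁ shorter
    where
    shorter : ∀ j → j < suc k → ¬ Walk Γ x y j
    shorter j (s≤s j≤k) with j ≟ℕ k
    ... | yes refl = ¬w
    ... | no j≢k = none j (≤∧≢⇒< j≤k j≢k)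

  dist-exists : ∀ {x y k} → Walk Γ x y k → ∃[ a ] Dist Γ x y a
  dist-exists {x} {y} {k} w with shortest-below x y (suc k)
  ... | inj₁ none = ⊥-elim (none k ≤-refl w)
  ... | inj₂ dist = dist

-- Adjacency generators.  δ x w is the distance from x to w in any graph that
-- contains H as an induced subgraph below a common neighbour of all its vertices.
module Adjacency {U : Set} (H : Graph U) (_≟_ : DecidableEquality U) where

  δ : U → U → ℕ
  δ x w with x ≟ w
  ... | yes _ = 0
  ... | no _ = if adj H x w then 1 else 2

  AdjacencyGenerator : List U → Set
  AdjacencyGenerator S = ∀ x y → adj H x y ≡ true → ∃[ w ] (w ∈ S × δ x w ≢ δ y w)

  record IsAdjacencyDim (k : ℕ) : Set where
    field
      basis     : List U
      unique    : Unique basis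
      generates : AdjacencyGenerator basis
      size      : length basis ≡ k
      minimal   : ∀ S → Unique S → AdjacencyGenerator S → k ≤ length S

  generator-nonempty : HasEdge H → ∀ {S} → AdjacencyGenerator S → ∃[ w ] w ∈ S
  generator-nonempty (x , y , x~y) gen with gen x y x~y
  ... | w , w∈S , _ = w , w∈S

record Cone {U V : Set} (H : Graph U) (Γ : Graph V) : Set where
  field
    emb      : U → V
    back     : V → Maybe U
    back-emb : ∀ u → back (emb u) ≡ just u
    emb-back : ∀ {v u} → back v ≡ just u → emb u ≡ v
    emb-adj  : ∀ x y → adj Γ (emb x) (emb y) ≡ adj H x y
    apex     : V
    apex-adj : ∀ u → adj Γ (emb u) apex ≡ true
    exits    : ∀ u v → adj Γ (emb u) v ≡ true → back v ≡ nothing → v ≡ apex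

module ConeFacts {U V : Set} {H : Graph U} {Γ : Graph V}
                 (_≟_ : DecidableEquality U) (C : Cone H Γ) where
  open Cone C
  open Adjacency H _≟_

  -- The copy is embedded injectively, and inside it distances are given by δ
  -- (paths of length 2 go through the apex).
  emb-injective : ∀ {x y} → emb x ≡ emb y → x ≡ y
  emb-injective {x} {y} e = just-injective (trans (sym (back-emb x)) (trans (cong back e) (back-emb y)))

  inside-dist : ∀ x w → Dist Γ (emb x) (emb w) (δ x w)
  inside-dist x w with x ≟ w
  ... | yes refl = self-dist Γ (emb x)
  ... | no x≢w with adj H x w in x?w
  ...   | true = edge-dist Γ (trans (emb-adj x w) x?w)
  ...   | false = two-step-dist Γ (x≢w ∘ emb-injective) (trans (emb-adj x w) x?w)
                    (apex-adj x) (trans (adj-sym Γ apex (emb w)) (apex-adj w))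

  exit : ∀ {u w k} → back w ≡ nothing → Walk Γ (emb u) w k → ∃[ c ] (Walk Γ apex w c × c < k)
  exit {u} out here with trans (sym (back-emb u)) out
  ... | ()
  exit {u} out (step {y = z} u~z r) with back z in bz
  ... | nothing = _ , subst (λ s → Walk Γ s _ _) (exits u z u~z bz) r , ≤-refl
  ... | just u′ with exit out (subst (λ s → Walk Γ s _ _) (sym (emb-back bz)) r)
  ...   | c , r′ , c<k = c , r′ , m≤n⇒m≤1+n c<k

  outside-dist : ∀ {w a} u → back w ≡ nothing → Dist Γ apex w a → Dist Γ (emb u) w (suc a)
  outside-dist u out (wa , min-a) = step (apex-adj u) wa , bound
    where
    bound : ∀ k → Walk Γ (emb u) _ k → suc _ ≤ k
    bound k r with exit out r
    ... | c , r′ , c<k = ≤-trans (s≤s (min-a c r′)) c<k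

  outside-uniform : ∀ {w a b x y} → back w ≡ nothing →
                    Dist Γ (emb x) w a → Dist Γ (emb y) w b → a ≡ b
  outside-uniform {w} out dx dy = ≤-antisym (closer dx dy) (closer dy dx)
    where
    closer : ∀ {a b x y} → Dist Γ (emb x) w a → Dist Γ (emb y) w b → a ≤ b
    closer {x = x} (_ , min-a) (wb , _) with exit out wb
    ... | c , r , c<b = ≤-trans (min-a (suc c) (step (apex-adj x) r)) c<b

  restrict-generator : ∀ {W} → IsLocalMetricGenerator Γ W → AdjacencyGenerator (mapMaybe back W)
  restrict-generator {W} gen x y x~y with gen (emb x) (emb y) (trans (emb-adj x y) x~y)
  ... | w , w∈W , a , b , da , db , a≢b with back w in bw
  ...   | nothing = ⊥-elim (a≢b (outside-uniform bw da db))
  ...   | just u = u , ∈-mapMaybe⁺ back w∈W bw , λ δx≡δy → a≢b (begin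
          a      ≡⟨ dist-unique Γ da (subst (λ v → Dist Γ (emb x) v (δ x u)) (emb-back bw) (inside-dist x u)) ⟩
          δ x u  ≡⟨ δx≡δy ⟩
          δ y u  ≡⟨ dist-unique Γ (subst (λ v → Dist Γ (emb y) v (δ y u)) (emb-back bw) (inside-dist y u)) db ⟩
          b      ∎)
    where open ≡-Reasoning

  restrict-unique : ∀ {W} → Unique W → Unique (mapMaybe back W)
  restrict-unique = mapMaybe-unique back (λ p q → trans (sym (emb-back p)) (emb-back q))

  resolve-inside : ∀ {S W} → AdjacencyGenerator S → (∀ {u} → u ∈ S → emb u ∈ W) →
                   ∀ x y → adj H x y ≡ true → Resolves Γ W (emb x) (emb y)
  resolve-inside gen S⊆W x y x~y with gen x y x~y
  ... | w , w∈S , δ≢ = emb w , S⊆W w∈S , δ x w , δ y w , inside-dist x w , inside-dist y w , δ≢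

basis-length : ∀ {V} (Γ : Graph V) {W W′} →
               IsLocalMetricBasis Γ W → IsLocalMetricBasis Γ W′ → length W ≡ length W′
basis-length Γ (u , gen , min) (u′ , gen′ , min′) = ≤-antisym (min _ u′ gen′) (min′ _ u gen)

module Join {U : Set} (H : Graph U) (_≟_ : DecidableEquality U) where
  open Adjacency H _≟_

  join-cone : Cone H (join-K1 H)
  join-cone = record
    { emb      = inj₂
    ; back     = [ const nothing , just ]
    ; back-emb = λ _ → refl
    ; emb-back = λ { {inj₂ _} refl → refl }
    ; emb-adj  = λ _ _ → refl
    ; apex     = inj₁ tt
    ; apex-adj = λ _ → refl
    ; exits    = λ { _ (inj₁ tt) _ _ → refl }
    }
  open Cone join-cone using (back)
  open ConeFacts _≟_ join-cone

  extend : List U → List (⊤ ⊎ U)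
  extend S = inj₁ tt ∷ map inj₂ S

  extend-unique : ∀ {S} → Unique S → Unique (extend S)
  extend-unique {S} u = All.map⁺ (universal (λ _ ()) S) ∷ Unique.map⁺ (λ { refl → refl }) u

  extend-generator : ∀ {S} → AdjacencyGenerator S → IsLocalMetricGenerator (join-K1 H) (extend S)
  extend-generator gen (inj₁ tt) (inj₂ y) _ = apex-resolves y
    where
    apex-resolves : ∀ y → Resolves (join-K1 H) (extend _) (inj₁ tt) (inj₂ y)
    apex-resolves y = inj₁ tt , here refl , 0 , 1 , self-dist _ _ , edge-dist _ refl , λ ()
  extend-generator gen (inj₂ x) (inj₁ tt) _ = resolves-sym _ (extend-generator gen (inj₁ tt) (inj₂ x) refl)
  extend-generator gen (inj₂ x) (inj₂ y) x~y = resolve-inside gen (there ∘ ∈-map⁺ inj₂) x y x~y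

  length-without-apex : ∀ W → inj₁ tt ∉ W → length (mapMaybe back W) ≡ length W
  length-without-apex [] _ = refl
  length-without-apex (inj₁ tt ∷ W) apex∉ = ⊥-elim (apex∉ (here refl))
  length-without-apex (inj₂ _ ∷ W) apex∉ = cong suc (length-without-apex W (apex∉ ∘ there))

  length-with-apex : ∀ {W} → Unique W → inj₁ tt ∈ W → suc (length (mapMaybe back W)) ≡ length W
  length-with-apex {inj₁ tt ∷ W} (apex∉ ∷ _) (here refl) =
    cong suc (length-without-apex W (All¬⇒¬Any apex∉))
  length-with-apex {inj₁ tt ∷ W} (apex∉ ∷ _) (there apex∈) = ⊥-elim (All¬⇒¬Any apex∉ apex∈)
  length-with-apex {inj₂ _ ∷ W} (_ ∷ u) (there apex∈) = cong suc (length-with-apex u apex∈)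

  -- A minimum adjacency generator: the restriction of a suitable local metric basis.
  reduced-basis : ∀ {d α} → IsLocalMetricDim (join-K1 H) d → Alpha H α →
                  ∃[ S ] (Unique S × AdjacencyGenerator S × length S ≡ d ∸ α)
  reduced-basis {d} (W , W-basis , |W|≡d) (inj₁ (refl , B , B-basis@(B-unique , B-gen , _) , apex∈B)) =
    mapMaybe back B , restrict-unique B-unique , restrict-generator B-gen , (begin
      length (mapMaybe back B)  ≡⟨ cong (_∸ 1) (length-with-apex B-unique apex∈B) ⟩
      length B ∸ 1             ≡⟨ cong (_∸ 1) (trans (basis-length _ B-basis W-basis) |W|≡d) ⟩
      d ∸ 1                    ∎)
    where open ≡-Reasoning
  reduced-basis (W , W-basis@(W-unique , W-gen , _) , |W|≡d) (inj₂ (refl , no-basis)) =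
    mapMaybe back W , restrict-unique W-unique , restrict-generator W-gen ,
    trans (length-without-apex W (λ apex∈W → no-basis (W , W-basis , apex∈W))) |W|≡d

  -- No adjacency generator is smaller: extending it by the apex gives a local
  -- metric generator, which is a basis containing the apex if it is too small.
  reduced-bound : ∀ {d α} → IsLocalMetricDim (join-K1 H) d → Alpha H α →
                  ∀ S → Unique S → AdjacencyGenerator S → d ∸ α ≤ length S
  reduced-bound {d} (W , (_ , _ , W-min) , |W|≡d) alpha S S-unique S-gen = bound alpha
    where
    |extend| : length (extend S) ≡ suc (length S)
    |extend| = cong suc (length-map inj₂ S)

    d≤1+|S| : d ≤ suc (length S)
    d≤1+|S| = subst₂ _≤_ |W|≡d |extend|
                (W-min (extend S) (extend-unique S-unique) (extend-generator S-gen))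

    bound : ∀ {α} → Alpha H α → d ∸ α ≤ length S
    bound (inj₁ (refl , _)) = ∸-monoˡ-≤ 1 d≤1+|S|
    bound (inj₂ (refl , no-basis)) with d ≤? length S
    ... | yes d≤|S| = d≤|S|
    ... | no d≰|S| = ⊥-elim (no-basis (extend S , extended-basis , here refl))
      where
      extended-minimal : ∀ W′ → Unique W′ → IsLocalMetricGenerator (join-K1 H) W′ →
                         length (extend S) ≤ length W′
      extended-minimal W′ u′ gen′ =
        subst (_≤ length W′) (trans |W|≡d (trans (≤-antisym d≤1+|S| (≰⇒> d≰|S|)) (sym |extend|)))
              (W-min W′ u′ gen′)

      extended-basis : IsLocalMetricBasis (join-K1 H) (extend S)
      extended-basis = extend-unique S-unique , extend-generator S-gen , extended-minimal

  join-reduction : ∀ {d α} → IsLocalMetricDim (join-K1 H) d → Alpha H α → IsAdjacencyDim (d ∸ α)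
  join-reduction dim alpha with reduced-basis dim alpha
  ... | S , S-unique , S-gen , |S| = record
    { basis = S ; unique = S-unique ; generates = S-gen ; size = |S|
    ; minimal = reduced-bound dim alpha }

other-vertex : ∀ {n} → 2 ≤ n → (l : Fin n) → ∃[ j ] j ≢ l
other-vertex (s≤s (s≤s z≤n)) zero = suc zero , λ ()
other-vertex (s≤s (s≤s z≤n)) (suc l) = zero , λ ()

module Corona {n : ℕ} (G : Graph (Fin n)) {m : Fin n → ℕ}
              (H : (i : Fin n) → Graph (Fin (m i))) where

  Γ : Graph (CoronaV n m)
  Γ = corona G H

  copy-copy-adj : ∀ i x y → adj Γ (inj₂ (i , x)) (inj₂ (i , y)) ≡ adj (H i) x y
  copy-copy-adj i x y with i ≟ᶠ i
  ... | yes refl = refl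
  ... | no i≢i = ⊥-elim (i≢i refl)

  copy-hub-adj : ∀ i x → adj Γ (inj₂ (i , x)) (inj₁ i) ≡ true
  copy-hub-adj i x with i ≟ᶠ i
  ... | yes _ = refl
  ... | no i≢i = ⊥-elim (i≢i refl)

  hub-copy-adj : ∀ i x → adj Γ (inj₁ i) (inj₂ (i , x)) ≡ true
  hub-copy-adj i x with i ≟ᶠ i
  ... | yes _ = refl
  ... | no i≢i = ⊥-elim (i≢i refl)

  hub-copy-nonadj : ∀ {l i} x → l ≢ i → adj Γ (inj₁ l) (inj₂ (i , x)) ≡ false
  hub-copy-nonadj {l} {i} x l≢i with l ≟ᶠ i
  ... | yes l≡i = ⊥-elim (l≢i l≡i)
  ... | no _ = refl

  hub-copy-edge : ∀ {l i} x → adj Γ (inj₁ l) (inj₂ (i , x)) ≡ true → l ≡ i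
  hub-copy-edge {l} {i} x l~x with l ≟ᶠ i
  ... | yes l≡i = l≡i
  hub-copy-edge x () | no _

  copy-edge : ∀ i x j y → adj Γ (inj₂ (i , x)) (inj₂ (j , y)) ≡ true →
              Σ (i ≡ j) λ { refl → adj (H i) x y ≡ true }
  copy-edge i x j y x~y with i ≟ᶠ j
  ... | yes refl = refl , x~y
  copy-edge i x j y () | no _

  copy-neighbour : ∀ {i x} v → adj Γ (inj₂ (i , x)) v ≡ true →
                   v ≡ inj₁ i ⊎ ∃[ y ] v ≡ inj₂ (i , y)
  copy-neighbour {i} (inj₁ l) x~l with l ≟ᶠ i
  ... | yes refl = inj₁ refl
  copy-neighbour (inj₁ l) () | no _
  copy-neighbour {i} {x} (inj₂ (j , y)) x~y with copy-edge i x j y x~y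
  ... | refl , _ = inj₂ (y , refl)

  back : (i : Fin n) → CoronaV n m → Maybe (Fin (m i))
  back i (inj₁ _) = nothing
  back i (inj₂ (j , y)) with j ≟ᶠ i
  ... | yes refl = just y
  ... | no _ = nothing

  back-other : ∀ {i j} y → j ≢ i → back i (inj₂ (j , y)) ≡ nothing
  back-other {i} {j} y j≢i with j ≟ᶠ i
  ... | yes j≡i = ⊥-elim (j≢i j≡i)
  ... | no _ = refl

  back-emb : ∀ i y → back i (inj₂ (i , y)) ≡ just y
  back-emb i y with i ≟ᶠ i
  ... | yes refl = refl
  ... | no i≢i = ⊥-elim (i≢i refl)

  emb-back : ∀ i {v y} → back i v ≡ just y → inj₂ (i , y) ≡ v
  emb-back i {inj₂ (j , y)} by with j ≟ᶠ i
  ... | yes refl = cong (λ z → inj₂ (i , z)) (just-injective (sym by))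

  copy : (i : Fin n) → Cone (H i) Γ
  copy i = record
    { emb      = λ y → inj₂ (i , y)
    ; back     = back i
    ; back-emb = back-emb i
    ; emb-back = emb-back i
    ; emb-adj  = copy-copy-adj i
    ; apex     = inj₁ i
    ; apex-adj = copy-hub-adj i
    ; exits    = exits
    }
    where
    exits : ∀ x v → adj Γ (inj₂ (i , x)) v ≡ true → back i v ≡ nothing → v ≡ inj₁ i
    exits x v x~v out with copy-neighbour v x~v
    ... | inj₁ v≡u = v≡u
    ... | inj₂ (y , refl) with trans (sym (back-emb i y)) out
    ...   | ()

  back-exclusive : ∀ {v i j y z} → back i v ≡ just y → back j v ≡ just z → i ≡ j
  back-exclusive {v} {i} {j} by bz with trans (emb-back i {v} by) (sym (emb-back j {v} bz))
  ... | refl = refl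

  _≟V_ : DecidableEquality (CoronaV n m)
  _≟V_ = Sum.≡-dec _≟ᶠ_ (Product.≡-dec _≟ᶠ_ _≟ᶠ_)

  any-vertex? : ∀ {P : CoronaV n m → Set} → (∀ v → Dec (P v)) → Dec (∃ P)
  any-vertex? P? =
    map′ (λ { (inj₁ (l , p)) → inj₁ l , p ; (inj₂ (i , y , p)) → inj₂ (i , y) , p })
         (λ { (inj₁ l , p) → inj₁ (l , p) ; (inj₂ (i , y) , p) → inj₂ (i , y , p) })
         (Fin.any? (P? ∘ inj₁) ⊎-dec Fin.any? (λ i → Fin.any? (λ y → P? (inj₂ (i , y)))))

  open ShortestWalks Γ _≟V_ any-vertex?

  lift-walk : ∀ {a b c} → Walk G a b c → Walk Γ (inj₁ a) (inj₁ b) c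
  lift-walk here = here
  lift-walk (step a~a′ r) = step a~a′ (lift-walk r)

  module _ (two : 2 ≤ n) (connected : Connected G) (has-edge : ∀ i → HasEdge (H i))
           (k : Fin n → ℕ) (dims : ∀ i → Adjacency.IsAdjacencyDim (H i) _≟ᶠ_ (k i)) where
    open Adjacency.IsAdjacencyDim

    S : (i : Fin n) → List (Fin (m i))
    S i = basis (dims i)

    copy-list : Fin n → List (CoronaV n m)
    copy-list i = map (λ y → inj₂ (i , y)) (S i)

    W₀ : List (CoronaV n m)
    W₀ = concat (tabulate copy-list)

    ∈W₀ : ∀ {i y} → y ∈ S i → inj₂ (i , y) ∈ W₀
    ∈W₀ {i} y∈ = ∈-concat⁺′ (∈-map⁺ _ y∈) (∈-tabulate⁺ i)

    nonempty : ∀ i → ∃[ y ] y ∈ S i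
    nonempty i = Adjacency.generator-nonempty (H i) _≟ᶠ_ (has-edge i) (generates (dims i))

    W₀-unique : Unique W₀
    W₀-unique = Unique.concat⁺
      (All.tabulate⁺ (λ i → Unique.map⁺ (λ { refl → refl }) (unique (dims i))))
      (AllPairs.tabulate⁺ disjoint)
      where
      disjoint : ∀ {i j} → i ≢ j → Disjoint (copy-list i) (copy-list j)
      disjoint i≢j (p , q) with ∈-map⁻ _ p | ∈-map⁻ _ q
      ... | _ , _ , refl | _ , _ , refl = i≢j refl

    W₀-length : length W₀ ≡ ∑ k
    W₀-length = begin
      length (concat (tabulate copy-list))   ≡⟨ length-concat (tabulate copy-list) ⟩
      sum (map length (tabulate copy-list))  ≡⟨ cong sum (map-tabulate copy-list length) ⟩
      ∑ (length ∘ copy-list)                 ≡⟨ cong sum (tabulate-cong size-of-copy) ⟩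
      ∑ k                                    ∎
      where
      open ≡-Reasoning
      size-of-copy : ∀ i → length (copy-list i) ≡ k i
      size-of-copy i = trans (length-map _ (S i)) (size (dims i))

    -- An edge uₗuₗ′ of G is resolved by any vertex of the copy at uₗ (distances 1 and 2).
    hub-hub : ∀ {l l′} → adj G l l′ ≡ true → Resolves Γ W₀ (inj₁ l) (inj₁ l′)
    hub-hub {l} {l′} l~l′ with nonempty l
    ... | y , y∈ = inj₂ (l , y) , ∈W₀ y∈ , 1 , 2 , edge-dist Γ (hub-copy-adj l y) ,
          two-step-dist Γ {z = inj₁ l} (λ ()) (hub-copy-nonadj y l′≢l) (trans (adj-sym G l′ l) l~l′) (hub-copy-adj l y) ,
          λ ()
      where
      l′≢l : l′ ≢ l
      l′≢l refl with trans (sym l~l′) (irrefl G l)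
      ... | ()

    -- An edge uₗx with x in the copy at uₗ is resolved by a vertex of another
    -- copy, which is one step further from x than from uₗ.
    hub-copy : ∀ l x → Resolves Γ W₀ (inj₁ l) (inj₂ (l , x))
    hub-copy l x with other-vertex two l
    ... | j , j≢l with nonempty j
    ... | y , y∈ with connected l j
    ... | _ , l⇝j with dist-exists (walk-snoc Γ (lift-walk l⇝j) (hub-copy-adj j y))
    ... | a , da = inj₂ (j , y) , ∈W₀ y∈ , a , suc a , da ,
                   ConeFacts.outside-dist _≟ᶠ_ (copy l) x (back-other y j≢l) da ,
                   λ a≡1+a → 1+n≢n (sym a≡1+a)

    W₀-generator : IsLocalMetricGenerator Γ W₀
    W₀-generator (inj₁ l) (inj₁ l′) l~l′ = hub-hub l~l′
    W₀-generator (inj₁ l) (inj₂ (i , x)) l~x with hub-copy-edge x l~x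
    ... | refl = hub-copy l x
    W₀-generator (inj₂ (i , x)) (inj₁ l) x~l with hub-copy-edge x (trans (adj-sym Γ (inj₁ l) (inj₂ (i , x))) x~l)
    ... | refl = resolves-sym Γ (hub-copy l x)
    W₀-generator (inj₂ (i , x)) (inj₂ (j , y)) x~y with copy-edge i x j y x~y
    ... | refl , x~y′ = ConeFacts.resolve-inside _≟ᶠ_ (copy i) (generates (dims i)) ∈W₀ x y x~y′

    -- Any local metric generator restricts to an adjacency generator of every copy.
    W₀-minimal : ∀ W → Unique W → IsLocalMetricGenerator Γ W → length W₀ ≤ length W
    W₀-minimal W W-unique W-gen = begin
      length W₀                                ≡⟨ W₀-length ⟩
      ∑ k                                      ≤⟨ ∑-mono restricted-bound ⟩
      ∑ (λ i → length (mapMaybe (back i) W))   ≤⟨ count-preimages back (λ {v} → back-exclusive {v}) W ⟩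
      length W                                 ∎
      where
      open ≤-Reasoning
      restricted-bound : ∀ i → k i ≤ length (mapMaybe (back i) W)
      restricted-bound i = minimal (dims i) _ (ConeFacts.restrict-unique _≟ᶠ_ (copy i) W-unique)
                                              (ConeFacts.restrict-generator _≟ᶠ_ (copy i) W-gen)

    corona-dimension : IsLocalMetricDim Γ (∑ k)
    corona-dimension = W₀ , (W₀-unique , W₀-generator , W₀-minimal) , W₀-length

corollary12 : (n : ℕ) → 2 ≤ n →
    (G : Graph (Fin n)) → Connected G →
    (m : Fin n → ℕ) → (H : (i : Fin n) → Graph (Fin (m i))) →
    (∀ i → HasEdge (H i)) →
    (d α : Fin n → ℕ) →
    (∀ j → IsLocalMetricDim (join-K1 (H j)) (d j)) →
    (∀ j → Alpha (H j) (α j)) →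
    IsLocalMetricDim (corona G H) (sum (map (λ j → d j ∸ α j) (allFin n)))
corollary12 n two G connected m H has-edge d α dims alphas =
  subst (IsLocalMetricDim (corona G H)) (cong sum (sym (map-tabulate id (λ j → d j ∸ α j))))
    (Corona.corona-dimension G H two connected has-edge (λ j → d j ∸ α j) adjacency-dims)
  where
  adjacency-dims : ∀ j → Adjacency.IsAdjacencyDim (H j) _≟ᶠ_ (d j ∸ α j)
  adjacency-dims j = Join.join-reduction (H j) _≟ᶠ_ (dims j) (alphas j)
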